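{- The class of quotient delta-matroids is closed under taking minors and under taking duals.
   Context: A set system is a pair $S=(E,\mathcal{F})$ with $E$ finite and $\mathcal{F}$ a collection of subsets of $E$; it is proper if $\mathcal{F}\neq\emptyset$. For proper $S$ and $e\in E$: $e$ is a loop if no feasible set contains $e$, a coloop if every feasible set contains $e$. If $e$ is not a loop, $S/e=(E-e,\{F-e:e\in F\in\mathcal{F}\})$; if $e$ is not a coloop, $S\backslash e=(E-e,\{F\in\mathcal{F}:e\notin F\})$; if $e$ is a loop or coloop, $S/e$ and $S\backslash e$ are both set equal to whichever was defined. A minor is any set system obtained by a (possibly empty) sequence of such operations. The dual is $S^*=(E,\{E-F:F\in\mathcal{F}\})$. A delta-matroid is a proper set system such that for all $X,Y\in\mathcal{F}$ and $u\in X\triangle Y$ there is $v\in X\triangle Y$ (possibly $v=u$) with $X\triangle\{u,v\}\in\mathcal{F}$. The stack of a proper $S$ with smallest feasible sets of size $k$ and largest of size $\ell$ is $N_k,\ldots,N_\ell$, $N_i=(E,\{F\in\mathcal{F}:|F|=i\})$. $S$ is a matroid stack set system if every proper $N_i$ is a matroid (its feasible sets are the bases of a matroid on $E$). For matroids $Q,L$ on $E$, $Q$ is a quotient of $L$ if there is a matroid $M$ and $X\subseteq E(M)$ with $M\backslash X=L$ and $M/X=Q$. A quotient set system is a matroid stack set system in which every matroid in the stack is a quotient of the matroid of next highest rank in the stack; a quotient delta-matroid is a quotient set system that is a delta-matroid. -}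

module Defs where

open import Data.Nat using (ℕ; zero; suc; _+_; _<_)
open import Data.Bool using (Bool; true; false; _∧_; _xor_)
open import Data.Fin using (Fin; zero; suc)
open import Data.Vec using (Vec; insertAt; zipWith)
open import Data.Fin.Subset using (Subset; _∈_; _∉_; ∁; ∣_∣; ⁅_⁆; _∪_; _─_; inside; outside)
open import Data.Product using (Σ; ∃; ∃-syntax; _×_; _,_)
open import Relation.Nullary using (¬_)
open import Relation.Binary.PropositionalEquality using (_≡_)

-- A set system on the ground set E = Fin n: the (finite) collection of
-- feasible sets given by its decidable membership function.
SetSystem : ℕ → Set
SetSystem n = Subset n → Bool

Feasible : ∀ {n} → SetSystem n → Subset n → Set
Feasible S X = S X ≡ true

Proper : ∀ {n} → SetSystem n → Set
Proper S = ∃[ X ] Feasible S X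

Loop : ∀ {n} → SetSystem n → Fin n → Set
Loop S e = ∀ X → Feasible S X → e ∉ X

Coloop : ∀ {n} → SetSystem n → Fin n → Set
Coloop S e = ∀ X → Feasible S X → e ∈ X

-- S / e  (feasible sets F - e with e ∈ F), ground set E - e  (Fin n)
contract : ∀ {n} → Fin (suc n) → SetSystem (suc n) → SetSystem n
contract e S X = S (insertAt X e inside)

-- S \ e  (feasible sets F with e ∉ F)
delete : ∀ {n} → Fin (suc n) → SetSystem (suc n) → SetSystem n
delete e S X = S (insertAt X e outside)

data Step {n : ℕ} (S : SetSystem (suc n)) : SetSystem n → Set where
  con     : Proper S → (e : Fin (suc n)) → ¬ Loop S e → Step S (contract e S)
  conLoop : Proper S → (e : Fin (suc n)) → Loop S e → Step S (delete e S)
  del     : Proper S → (e : Fin (suc n)) → ¬ Coloop S e → Step S (delete e S)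
  delColoop : Proper S → (e : Fin (suc n)) → Coloop S e → Step S (contract e S)

data Minor : ∀ {n m} → SetSystem n → SetSystem m → Set where
  here  : ∀ {n} {S : SetSystem n} → Minor S S
  there : ∀ {n m} {S : SetSystem (suc n)} {T : SetSystem n} {U : SetSystem m} →
          Step S T → Minor T U → Minor S U

dual : ∀ {n} → SetSystem n → SetSystem n
dual S X = S (∁ X)

_△_ : ∀ {n} → Subset n → Subset n → Subset n
X △ Y = zipWith _xor_ X Y

IsDeltaMatroid : ∀ {n} → SetSystem n → Set
IsDeltaMatroid {n} S =
  Proper S ×
  (∀ X Y → Feasible S X → Feasible S Y → (u : Fin n) → u ∈ (X △ Y) →
     ∃[ v ] (v ∈ (X △ Y) × Feasible S (X △ (⁅ u ⁆ ∪ ⁅ v ⁆))))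

-- Matroid given by its collection of bases (basis axioms).
IsMatroid : ∀ {n} → SetSystem n → Set
IsMatroid {n} B =
  Proper B ×
  (∀ B₁ B₂ → Feasible B B₁ → Feasible B B₂ → (x : Fin n) → x ∈ B₁ → x ∉ B₂ →
     ∃[ y ] (y ∈ B₂ × y ∉ B₁ × Feasible B ((B₁ ─ ⁅ x ⁆) ∪ ⁅ y ⁆)))

layer : ∀ {n} → ℕ → SetSystem n → SetSystem n
layer i S X = S X ∧ (∣ X ∣ Data.Nat.≡ᵇ i)

IsMatroidStack : ∀ {n} → SetSystem n → Set
IsMatroidStack S = ∀ i → Proper (layer i S) → IsMatroid (layer i S)

-- Matroid on Fin (k + n); X = the first k elements, E = the last n.
-- DeleteFirst k M L : L = M \ X ;  ContractFirst k M Q : Q = M / X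
-- (element-by-element, with the coloop/loop conventions for bases).
data DeleteFirst {n : ℕ} : (k : ℕ) → SetSystem (k + n) → SetSystem n → Set where
  done : ∀ {S} → DeleteFirst 0 S S
  stepD : ∀ {k S T} → ¬ Coloop S zero → DeleteFirst k (delete zero S) T → DeleteFirst (suc k) S T
  stepC : ∀ {k S T} → Coloop S zero → DeleteFirst k (contract zero S) T → DeleteFirst (suc k) S T

data ContractFirst {n : ℕ} : (k : ℕ) → SetSystem (k + n) → SetSystem n → Set where
  done : ∀ {S} → ContractFirst 0 S S
  stepC : ∀ {k S T} → ¬ Loop S zero → ContractFirst k (contract zero S) T → ContractFirst (suc k) S T
  stepD : ∀ {k S T} → Loop S zero → ContractFirst k (delete zero S) T → ContractFirst (suc k) S T

IsQuotientOf : ∀ {n} → SetSystem n → SetSystem n → Set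
IsQuotientOf {n} Q L =
  ∃[ k ] Σ (SetSystem (k + n)) λ M → Σ (SetSystem n) λ L' → Σ (SetSystem n) λ Q' →
    IsMatroid M × DeleteFirst k M L' × ContractFirst k M Q' ×
    (∀ X → L' X ≡ L X) × (∀ X → Q' X ≡ Q X)

IsQuotientSetSystem : ∀ {n} → SetSystem n → Set
IsQuotientSetSystem S =
  IsMatroidStack S ×
  (∀ i j → i < j → Proper (layer i S) → Proper (layer j S) →
     (∀ l → i < l → l < j → ¬ Proper (layer l S)) →
     IsQuotientOf (layer i S) (layer j S))

IsQuotientDeltaMatroid : ∀ {n} → SetSystem n → Set
IsQuotientDeltaMatroid S = IsQuotientSetSystem S × IsDeltaMatroid S

module Submission where

-- Deletion is dual to contraction, S \ e = (S* / e)*, so it suffices to show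
-- closure under duality and under contraction of an element e with S / e
-- proper (contracting a non-loop or a coloop).
--
-- Duality: the layer N_i of S* is the dual of the layer N_(n-i) of S.  Matroid
-- duality reverses quotients (dualise the witnessing matroid M, which swaps its
-- deletions and contractions), and the delta-matroid exchange axiom is
-- invariant under complementation.
--
-- Contraction: the layers of S / e are the N_(i+1) / e, and a quotient witness
-- M for N_i, N_j is contracted at e.  Consecutive layers of S / e come from
-- consecutive layers of S: if N_l were the least non-empty layer strictly
-- between N_(i+1) and N_(j+1), then N_(i+1) is a quotient of N_l, so e is not a
-- loop of N_l either, and N_l / e would be a layer of S / e strictly between.

open import Defs
open import Data.Nat using (ℕ)
open import Data.Product using (_×_)

open import Data.Bool using (Bool; true; false; not; T; _∧_; _∨_; _xor_) renaming (_≟_ to _≟ᵇ_)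
open import Data.Bool.Properties
  using (∧-identityʳ; ∧-zeroʳ; ∨-identityʳ; not-involutive; xor-same; xor-identityʳ; xor-annihilates-not; not-distribˡ-xor)
open import Data.Fin using (Fin; zero; suc; punchIn; punchOut; _↑ʳ_; _≟_)
open import Data.Fin.Properties using (punchIn-punchOut; any?)
open import Data.Fin.Subset using (Subset; _∈_; _∉_; ∁; ⁅_⁆; _∪_; _─_; _⊆_; ∣_∣; inside; outside; ⊥)
open import Data.Fin.Subset.Properties
  using (_∈?_; anySubset?; x∈⁅x⁆; x∈⁅y⁆⇒x≡y; x≢y⇒x∉⁅y⁆; x∉⁅y⁆⇒x≢y; x∈p∪q⁺; x∈p∪q⁻; x∈p∧x∉q⇒x∈p─q; p─q⊆p;
         x∈∁p⇒x∉p; x∉∁p⇒x∈p; x∉p⇒x∈∁p; x∈p⇒x∉∁p; p⊂q⇒∣p∣<∣q∣; ∣p∣≤n; ∣∁p∣≡n∸∣p∣)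
open import Data.Nat using (zero; suc; _+_; _∸_; _<_; _≤_; s<s; _≡ᵇ_) renaming (_≟_ to _≟ℕ_)
open import Data.Nat.Induction using (<-wellFounded)
open import Data.Nat.Properties using (≡ᵇ⇒≡; ∸-cancelˡ-≡; <-trans; ≤-pred; ∸-monoʳ-<; m∸n≤m; m∸[m∸n]≡n)
open import Data.Product using (∃-syntax; _,_; proj₁; proj₂)
open import Data.Sum using (_⊎_; inj₁; inj₂)
open import Data.Vec using (Vec; []; _∷_; here; there; insertAt; removeAt; zipWith; lookup; map)
open import Data.Vec.Properties
  using (insertAt-lookup; insertAt-punchIn; insertAt-removeAt; map-insertAt; lookup-map; lookup-zipWith;
         []=⇒lookup; lookup⇒[]=; tabulate∘lookup; tabulate-cong)
open import Function using (_∘_)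
open import Induction.WellFounded using (Acc; acc)
open import Level using (Level)
open import Relation.Binary.PropositionalEquality
open import Relation.Nullary using (¬_; yes; no; does; contradiction)
open import Relation.Nullary.Decidable using (_×-dec_; ¬?; decidable-stable; map′; does-≡)

private variable
  ℓ ℓ′ ℓ″ : Level
  A : Set ℓ
  B : Set ℓ′
  C : Set ℓ″
  n : ℕ

-- Subsets

∈⇒lookup : ∀ {x : Fin n} {p} → x ∈ p → lookup p x ≡ true
∈⇒lookup = []=⇒lookup

lookup⇒∈ : ∀ {x : Fin n} {p} → lookup p x ≡ true → x ∈ p
lookup⇒∈ {x = x} {p} = lookup⇒[]= x p

∉⇒lookup : ∀ {x : Fin n} {p} → x ∉ p → lookup p x ≡ false
∉⇒lookup {x = x} {p} x∉p with lookup p x in eq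
... | true  = contradiction (lookup⇒∈ eq) x∉p
... | false = refl

subset-ext : ∀ {p q : Subset n} → (∀ i → lookup p i ≡ lookup q i) → p ≡ q
subset-ext {p = p} {q} same = trans (sym (tabulate∘lookup p)) (trans (tabulate-cong same) (tabulate∘lookup q))

x∈p─q⇒x∉q : ∀ {x : Fin n} (p q : Subset n) → x ∈ p ─ q → x ∉ q
x∈p─q⇒x∉q (_ ∷ p) (outside ∷ q) here        ()
x∈p─q⇒x∉q (_ ∷ p) (_       ∷ q) (there x∈)  (there x∈q) = x∈p─q⇒x∉q p q x∈ x∈q

lookup-─ : ∀ (p q : Subset n) i → lookup (p ─ q) i ≡ lookup p i ∧ not (lookup q i)
lookup-─ (b ∷ p) (outside ∷ q) zero    = sym (∧-identityʳ b)
lookup-─ (b ∷ p) (inside  ∷ q) zero    = sym (∧-zeroʳ b)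
lookup-─ (_ ∷ p) (_       ∷ q) (suc i) = lookup-─ p q i

lookup-⁅⁆ : ∀ (y i : Fin n) → lookup ⁅ y ⁆ i ≡ does (i ≟ y)
lookup-⁅⁆ y i with i ≟ y
... | yes refl = ∈⇒lookup (x∈⁅x⁆ y)
... | no  i≢y  = ∉⇒lookup (x≢y⇒x∉⁅y⁆ i≢y)

∁-involutive : ∀ (p : Subset n) → ∁ (∁ p) ≡ p
∁-involutive []      = refl
∁-involutive (x ∷ p) = cong₂ _∷_ (not-involutive x) (∁-involutive p)

∁-△ : ∀ (p q : Subset n) → ∁ p △ ∁ q ≡ p △ q
∁-△ []      []      = refl
∁-△ (x ∷ p) (y ∷ q) = cong₂ _∷_ (xor-annihilates-not x y) (∁-△ p q)

∁-distribˡ-△ : ∀ (p q : Subset n) → ∁ (p △ q) ≡ ∁ p △ q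
∁-distribˡ-△ []      []      = refl
∁-distribˡ-△ (x ∷ p) (y ∷ q) = cong₂ _∷_ (not-distribˡ-xor x y) (∁-distribˡ-△ p q)

exchange : Subset n → Fin n → Fin n → Subset n
exchange p x y = (p ─ ⁅ x ⁆) ∪ ⁅ y ⁆

∈-exchange⁺ : ∀ {p : Subset n} {x y i} → i ∈ p → i ≢ x → i ∈ exchange p x y
∈-exchange⁺ i∈p i≢x = x∈p∪q⁺ (inj₁ (x∈p∧x∉q⇒x∈p─q i∈p (x≢y⇒x∉⁅y⁆ i≢x)))

∈-exchange⁻ : ∀ (p : Subset n) x y {i} → i ∈ exchange p x y → (i ∈ p × i ≢ x) ⊎ i ≡ y
∈-exchange⁻ p x y i∈ with x∈p∪q⁻ (p ─ ⁅ x ⁆) ⁅ y ⁆ i∈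
... | inj₁ i∈p─x = inj₁ (p─q⊆p p ⁅ x ⁆ i∈p─x , x∉⁅y⁆⇒x≢y (x∈p─q⇒x∉q p ⁅ x ⁆ i∈p─x))
... | inj₂ i∈y   = inj₂ (x∈⁅y⁆⇒x≡y y i∈y)

lookup-exchange : ∀ (p : Subset n) x y i →
                  lookup (exchange p x y) i ≡ (lookup p i ∧ not (does (i ≟ x))) ∨ does (i ≟ y)
lookup-exchange p x y i = begin
  lookup ((p ─ ⁅ x ⁆) ∪ ⁅ y ⁆) i                ≡⟨ lookup-zipWith _∨_ i (p ─ ⁅ x ⁆) ⁅ y ⁆ ⟩
  lookup (p ─ ⁅ x ⁆) i ∨ lookup ⁅ y ⁆ i          ≡⟨ cong₂ _∨_ (lookup-─ p ⁅ x ⁆ i) (lookup-⁅⁆ y i) ⟩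
  (lookup p i ∧ not (lookup ⁅ x ⁆ i)) ∨ does (i ≟ y) ≡⟨ cong (λ b → (lookup p i ∧ not b) ∨ does (i ≟ y)) (lookup-⁅⁆ x i) ⟩
  (lookup p i ∧ not (does (i ≟ x))) ∨ does (i ≟ y) ∎
  where open ≡-Reasoning

exchange-closer : ∀ {B B₁ : Subset n} {z w} → z ∈ B → z ∉ B₁ → w ∈ B₁ → w ∉ B →
                  ∣ exchange B z w ─ B₁ ∣ < ∣ B ─ B₁ ∣
exchange-closer {B = B} {B₁} {z} {w} z∈B z∉B₁ w∈B₁ w∉B =
  p⊂q⇒∣p∣<∣q∣ (outside-B₁ , z , x∈p∧x∉q⇒x∈p─q z∈B z∉B₁ , z∉)
  where
  outside-B₁ : exchange B z w ─ B₁ ⊆ B ─ B₁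
  outside-B₁ i∈ with ∈-exchange⁻ B z w (p─q⊆p _ B₁ i∈)
  ... | inj₁ (i∈B , _) = x∈p∧x∉q⇒x∈p─q i∈B (x∈p─q⇒x∉q _ B₁ i∈)
  ... | inj₂ refl      = contradiction w∈B₁ (x∈p─q⇒x∉q _ B₁ i∈)
  z∉ : z ∉ exchange B z w ─ B₁
  z∉ z∈ with ∈-exchange⁻ B z w (p─q⊆p _ B₁ z∈)
  ... | inj₁ (_ , z≢z) = z≢z refl
  ... | inj₂ refl      = w∉B z∈B

∁-exchange : ∀ {p : Subset n} {x y} → x ∈ p → y ∉ p → ∁ (exchange p x y) ≡ exchange (∁ p) y x
∁-exchange {p = p} {x} {y} x∈p y∉p = subset-ext pointwise
  where
  pointwise : ∀ i → lookup (∁ (exchange p x y)) i ≡ lookup (exchange (∁ p) y x) i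
  pointwise i rewrite lookup-map i not (exchange p x y) | lookup-exchange p x y i
                    | lookup-exchange (∁ p) y x i | lookup-map i not p
    with i ≟ x | i ≟ y
  ... | yes refl | yes refl = contradiction x∈p y∉p
  ... | yes refl | no _ rewrite ∈⇒lookup x∈p = refl
  ... | no _ | yes refl rewrite ∉⇒lookup y∉p = refl
  ... | no _ | no _ with lookup p i
  ...   | true  = refl
  ...   | false = refl

-- A quotient witness lives on Fin (k + n) with its k extra elements first, so
-- the element e of the ground set sits at k ↑ʳ e; insertAt⁺ k inserts a
-- coordinate there and punchIn⁺ k e embeds the remaining indices.
punchIn⁺ : ∀ k {n} → Fin (suc n) → Fin (k + n) → Fin (k + suc n)
punchIn⁺ zero    e i       = punchIn e i
punchIn⁺ (suc k) e zero    = zero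
punchIn⁺ (suc k) e (suc i) = suc (punchIn⁺ k e i)

insertAt⁺ : ∀ k {n} → Vec A (k + n) → Fin (suc n) → A → Vec A (k + suc n)
insertAt⁺ zero    xs       e v = insertAt xs e v
insertAt⁺ (suc k) (x ∷ xs) e v = x ∷ insertAt⁺ k xs e v

removeAt⁺ : ∀ k {n} → Vec A (k + suc n) → Fin (suc n) → Vec A (k + n)
removeAt⁺ zero    xs       e = removeAt xs e
removeAt⁺ (suc k) (x ∷ xs) e = x ∷ removeAt⁺ k xs e

insertAt⁺-lookup : ∀ k {n} (xs : Vec A (k + n)) e v → lookup (insertAt⁺ k xs e v) (k ↑ʳ e) ≡ v
insertAt⁺-lookup zero    xs       e v = insertAt-lookup xs e v
insertAt⁺-lookup (suc k) (x ∷ xs) e v = insertAt⁺-lookup k xs e v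

insertAt⁺-punchIn⁺ : ∀ k {n} (xs : Vec A (k + n)) e v i →
                     lookup (insertAt⁺ k xs e v) (punchIn⁺ k e i) ≡ lookup xs i
insertAt⁺-punchIn⁺ zero    xs       e v i       = insertAt-punchIn xs e v i
insertAt⁺-punchIn⁺ (suc k) (x ∷ xs) e v zero    = refl
insertAt⁺-punchIn⁺ (suc k) (x ∷ xs) e v (suc i) = insertAt⁺-punchIn⁺ k xs e v i

insertAt⁺-removeAt⁺ : ∀ k {n} (xs : Vec A (k + suc n)) e →
                      insertAt⁺ k (removeAt⁺ k xs e) e (lookup xs (k ↑ʳ e)) ≡ xs
insertAt⁺-removeAt⁺ zero    xs       e = insertAt-removeAt xs e
insertAt⁺-removeAt⁺ (suc k) (x ∷ xs) e = cong (x ∷_) (insertAt⁺-removeAt⁺ k xs e)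

insertAt⁺-zipWith : ∀ (f : A → B → C) k {n}
                    (xs : Vec A (k + n)) (ys : Vec B (k + n)) e v w →
                    zipWith f (insertAt⁺ k xs e v) (insertAt⁺ k ys e w) ≡ insertAt⁺ k (zipWith f xs ys) e (f v w)
insertAt⁺-zipWith f zero    xs       ys       zero    v w = refl
insertAt⁺-zipWith f zero    (x ∷ xs) (y ∷ ys) (suc e) v w = cong (f x y ∷_) (insertAt⁺-zipWith f zero xs ys e v w)
insertAt⁺-zipWith f (suc k) (x ∷ xs) (y ∷ ys) e       v w = cong (f x y ∷_) (insertAt⁺-zipWith f k xs ys e v w)

punchIn⁺-surjective : ∀ k {n} (e : Fin (suc n)) j → j ≢ k ↑ʳ e → ∃[ i ] punchIn⁺ k e i ≡ j
punchIn⁺-surjective zero    e j       j≢e = punchOut (j≢e ∘ sym) , punchIn-punchOut (j≢e ∘ sym)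
punchIn⁺-surjective (suc k) e zero    _   = zero , refl
punchIn⁺-surjective (suc k) e (suc j) j≢e with punchIn⁺-surjective k e j (j≢e ∘ cong suc)
... | i , refl = suc i , refl

insertAt⁺-⊥ : ∀ k {n} (e : Fin (suc n)) → insertAt⁺ k (⊥ {k + n}) e false ≡ ⊥
insertAt⁺-⊥ zero    zero            = refl
insertAt⁺-⊥ zero    {suc n} (suc e) = cong (false ∷_) (insertAt⁺-⊥ zero e)
insertAt⁺-⊥ (suc k) e               = cong (false ∷_) (insertAt⁺-⊥ k e)

⁅punchIn⁺⁆ : ∀ k {n} (e : Fin (suc n)) i → ⁅ punchIn⁺ k e i ⁆ ≡ insertAt⁺ k ⁅ i ⁆ e false
⁅punchIn⁺⁆ zero    zero    i       = refl
⁅punchIn⁺⁆ zero    (suc e) zero    = cong (true ∷_) (sym (insertAt⁺-⊥ zero e))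
⁅punchIn⁺⁆ zero    (suc e) (suc i) = cong (false ∷_) (⁅punchIn⁺⁆ zero e i)
⁅punchIn⁺⁆ (suc k) e       zero    = cong (true ∷_) (sym (insertAt⁺-⊥ k e))
⁅punchIn⁺⁆ (suc k) e       (suc i) = cong (false ∷_) (⁅punchIn⁺⁆ k e i)

BasisExchange : SetSystem n → Set
BasisExchange M = ∀ B₁ B₂ → Feasible M B₁ → Feasible M B₂ → ∀ x → x ∈ B₁ → x ∉ B₂ →
                  ∃[ y ] (y ∈ B₂ × y ∉ B₁ × Feasible M (exchange B₁ x y))

DeltaExchange : SetSystem n → Set
DeltaExchange S = ∀ X Y → Feasible S X → Feasible S Y → ∀ u → u ∈ X △ Y →
                  ∃[ v ] (v ∈ X △ Y × Feasible S (X △ (⁅ u ⁆ ∪ ⁅ v ⁆)))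

infix 4 _≐_
_≐_ : SetSystem n → SetSystem n → Set
S ≐ T = ∀ X → S X ≡ T X

≐-sym : {S T : SetSystem n} → S ≐ T → T ≐ S
≐-sym S≐T X = sym (S≐T X)

module _ {S T : SetSystem n} (S≐T : S ≐ T) where

  feasible-resp : ∀ {X} → Feasible S X → Feasible T X
  feasible-resp {X} = trans (sym (S≐T X))

  feasible-resp⁻ : ∀ {X} → Feasible T X → Feasible S X
  feasible-resp⁻ {X} = trans (S≐T X)

  proper-resp : Proper S → Proper T
  proper-resp (X , f) = X , feasible-resp f

  layer-resp : ∀ i → layer i S ≐ layer i T
  layer-resp i X = cong (_∧ _) (S≐T X)

  matroid-resp : IsMatroid S → IsMatroid T
  matroid-resp (proper , exchangeOut) = proper-resp proper , λ B₁ B₂ f₁ f₂ x x∈ x∉ →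
    let y , y∈ , y∉ , f = exchangeOut B₁ B₂ (feasible-resp⁻ f₁) (feasible-resp⁻ f₂) x x∈ x∉
    in  y , y∈ , y∉ , feasible-resp f

  deltaMatroid-resp : IsDeltaMatroid S → IsDeltaMatroid T
  deltaMatroid-resp (proper , exchange) = proper-resp proper , λ X Y fX fY u u∈ →
    let v , v∈ , f = exchange X Y (feasible-resp⁻ fX) (feasible-resp⁻ fY) u u∈
    in  v , v∈ , feasible-resp f

quotientOf-resp : {Q Q′ L L′ : SetSystem n} → Q ≐ Q′ → L ≐ L′ → IsQuotientOf Q L → IsQuotientOf Q′ L′
quotientOf-resp Q≐Q′ L≐L′ (k , M , L″ , Q″ , isMatroid , deleteFirst , contractFirst , L″≐L , Q″≐Q) =
  k , M , L″ , Q″ , isMatroid , deleteFirst , contractFirst ,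
  (λ X → trans (L″≐L X) (L≐L′ X)) , (λ X → trans (Q″≐Q X) (Q≐Q′ X))

quotientDeltaMatroid-resp : {S T : SetSystem n} → S ≐ T → IsQuotientDeltaMatroid S → IsQuotientDeltaMatroid T
quotientDeltaMatroid-resp {S = S} {T} S≐T ((isStack , isQuotient) , isDeltaMatroid) =
  ( (λ i proper → matroid-resp (layer-resp S≐T i) (isStack i (toS i proper)))
  , (λ i j i<j properᵢ properⱼ gap →
       quotientOf-resp (layer-resp S≐T i) (layer-resp S≐T j)
         (isQuotient i j i<j (toS i properᵢ) (toS j properⱼ)
           (λ l i<l l<j → gap l i<l l<j ∘ proper-resp (layer-resp S≐T l)))))
  , deltaMatroid-resp S≐T isDeltaMatroid
  where
  toS : ∀ i → Proper (layer i T) → Proper (layer i S)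
  toS i = proper-resp (layer-resp (≐-sym S≐T) i)

-- Minors

-- Contraction (b = true) or deletion (b = false) of the element k ↑ʳ e;
-- minorAt 0 e true and minorAt 0 e false are contract e and delete e.
minorAt : ∀ k {n} → Fin (suc n) → Bool → SetSystem (k + suc n) → SetSystem (k + n)
minorAt k e b M X = M (insertAt⁺ k X e b)

minorAt-feasible : ∀ k {n} e b {M : SetSystem (k + suc n)} {X} →
                   Feasible M X → lookup X (k ↑ʳ e) ≡ b → Feasible (minorAt k e b M) (removeAt⁺ k X e)
minorAt-feasible k e _ {M} {X} f refl = trans (cong M (insertAt⁺-removeAt⁺ k X e)) f

minorAt-proper : ∀ k {n} e b {M : SetSystem (k + suc n)} {X} →
                 Feasible M X → lookup X (k ↑ʳ e) ≡ b → Proper (minorAt k e b M)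
minorAt-proper k e b {M} {X} f X↑ʳe≡b = removeAt⁺ k X e , minorAt-feasible k e b {M} f X↑ʳe≡b

minorAt-proper⁻ : ∀ k {n} e b {M : SetSystem (k + suc n)} → Proper (minorAt k e b M) → Proper M
minorAt-proper⁻ k e b (X , f) = insertAt⁺ k X e b , f

module _ {S : SetSystem (suc n)} {e : Fin (suc n)} where

  contract-proper : ∀ {X} → Feasible S X → e ∈ X → Proper (contract e S)
  contract-proper f e∈X = minorAt-proper 0 e true {S} f (∈⇒lookup e∈X)

  delete-proper : ∀ {X} → Feasible S X → e ∉ X → Proper (delete e S)
  delete-proper f e∉X = minorAt-proper 0 e false {S} f (∉⇒lookup e∉X)

  ¬loop⇒contract-proper : ¬ Loop S e → Proper (contract e S)
  ¬loop⇒contract-proper ¬loop with anySubset? (λ X → (S X ≟ᵇ true) ×-dec (e ∈? X))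
  ... | yes (X , f , e∈X) = contract-proper f e∈X
  ... | no  none          = contradiction (λ X f e∈X → none (X , f , e∈X)) ¬loop

  ¬coloop⇒delete-proper : ¬ Coloop S e → Proper (delete e S)
  ¬coloop⇒delete-proper ¬coloop with anySubset? (λ X → (S X ≟ᵇ true) ×-dec ¬? (e ∈? X))
  ... | yes (X , f , e∉X) = delete-proper f e∉X
  ... | no  none          =
    contradiction (λ X f → decidable-stable (e ∈? X) (λ e∉X → none (X , f , e∉X))) ¬coloop

  loop⇒delete-proper : Proper S → Loop S e → Proper (delete e S)
  loop⇒delete-proper (X , f) loop = delete-proper f (loop X f)

  coloop⇒contract-proper : Proper S → Coloop S e → Proper (contract e S)
  coloop⇒contract-proper (X , f) coloop = contract-proper f (coloop X f)

  contract-proper⇒¬loop : Proper (contract e S) → ¬ Loop S e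
  contract-proper⇒¬loop (X , f) loop = loop _ f (lookup⇒∈ (insertAt-lookup X e true))

module _ {k n} {e : Fin (suc n)} {b : Bool} {M : SetSystem (suc k + suc n)} where

  loop-minorAt : Loop M zero → Loop (minorAt (suc k) e b M) zero
  loop-minorAt loop (true ∷ X) f here = loop _ f here

  coloop-minorAt : Coloop M zero → Coloop (minorAt (suc k) e b M) zero
  coloop-minorAt coloop (x ∷ X) f with coloop _ f
  ... | here = here

module _ (k : ℕ) {n} (e : Fin (suc n)) where

  ∈-insertAt⁺ : ∀ {X : Subset (k + n)} {b i} → i ∈ X → punchIn⁺ k e i ∈ insertAt⁺ k X e b
  ∈-insertAt⁺ {X} {b} {i} i∈X = lookup⇒∈ (trans (insertAt⁺-punchIn⁺ k X e b i) (∈⇒lookup i∈X))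

  ∈-insertAt⁺⁻ : ∀ {X : Subset (k + n)} {b i} → punchIn⁺ k e i ∈ insertAt⁺ k X e b → i ∈ X
  ∈-insertAt⁺⁻ {X} {b} {i} i∈ = lookup⇒∈ (trans (sym (insertAt⁺-punchIn⁺ k X e b i)) (∈⇒lookup i∈))

  ↑ʳ∈-insertAt⁺ : ∀ {X Y : Subset (k + n)} {b} → k ↑ʳ e ∈ insertAt⁺ k X e b → k ↑ʳ e ∈ insertAt⁺ k Y e b
  ↑ʳ∈-insertAt⁺ {X} {Y} {b} ∈X =
    lookup⇒∈ (trans (insertAt⁺-lookup k Y e b) (trans (sym (insertAt⁺-lookup k X e b)) (∈⇒lookup ∈X)))

  exchange-insertAt⁺ : ∀ (X : Subset (k + n)) b x y →
    exchange (insertAt⁺ k X e b) (punchIn⁺ k e x) (punchIn⁺ k e y) ≡ insertAt⁺ k (exchange X x y) e b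
  exchange-insertAt⁺ X b x y = begin
    (insertAt⁺ k X e b ─ ⁅ punchIn⁺ k e x ⁆) ∪ ⁅ punchIn⁺ k e y ⁆
      ≡⟨ cong₂ (λ p q → (insertAt⁺ k X e b ─ p) ∪ q) (⁅punchIn⁺⁆ k e x) (⁅punchIn⁺⁆ k e y) ⟩
    (insertAt⁺ k X e b ─ insertAt⁺ k ⁅ x ⁆ e false) ∪ insertAt⁺ k ⁅ y ⁆ e false
      ≡⟨ cong (_∪ insertAt⁺ k ⁅ y ⁆ e false) (insertAt⁺-zipWith _ k X ⁅ x ⁆ e b false) ⟩  -- _─_ is a zipWith
    insertAt⁺ k (X ─ ⁅ x ⁆) e b ∪ insertAt⁺ k ⁅ y ⁆ e false
      ≡⟨ insertAt⁺-zipWith _∨_ k (X ─ ⁅ x ⁆) ⁅ y ⁆ e b false ⟩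
    insertAt⁺ k (exchange X x y) e (b ∨ false)
      ≡⟨ cong (insertAt⁺ k (exchange X x y) e) (∨-identityʳ b) ⟩
    insertAt⁺ k (exchange X x y) e b ∎
    where open ≡-Reasoning

  insertAt⁺-△ : ∀ (X Y : Subset (k + n)) b c → insertAt⁺ k X e b △ insertAt⁺ k Y e c ≡ insertAt⁺ k (X △ Y) e (b xor c)
  insertAt⁺-△ X Y b c = insertAt⁺-zipWith _xor_ k X Y e b c

  △-insertAt⁺ : ∀ (X Y : Subset (k + n)) b → insertAt⁺ k X e b △ insertAt⁺ k Y e b ≡ insertAt⁺ k (X △ Y) e false
  △-insertAt⁺ X Y b = trans (insertAt⁺-△ X Y b b) (cong (insertAt⁺ k (X △ Y) e) (xor-same b))

  ∈-△-insertAt⁺ : ∀ {X Y : Subset (k + n)} {b u} → u ∈ X △ Y → punchIn⁺ k e u ∈ insertAt⁺ k X e b △ insertAt⁺ k Y e b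
  ∈-△-insertAt⁺ {X} {Y} {b} = subst (_ ∈_) (sym (△-insertAt⁺ X Y b)) ∘ ∈-insertAt⁺

  ∈-△-insertAt⁺⁻ : ∀ {X Y : Subset (k + n)} {b u} → punchIn⁺ k e u ∈ insertAt⁺ k X e b △ insertAt⁺ k Y e b → u ∈ X △ Y
  ∈-△-insertAt⁺⁻ {X} {Y} {b} = ∈-insertAt⁺⁻ ∘ subst (_ ∈_) (△-insertAt⁺ X Y b)

  ↑ʳ∉-△-insertAt⁺ : ∀ {X Y : Subset (k + n)} {b} → k ↑ʳ e ∉ insertAt⁺ k X e b △ insertAt⁺ k Y e b
  ↑ʳ∉-△-insertAt⁺ {X} {Y} {b} ↑ʳ∈ =
    contradiction (trans (sym (∈⇒lookup (subst (_ ∈_) (△-insertAt⁺ X Y b) ↑ʳ∈))) (insertAt⁺-lookup k (X △ Y) e false)) λ ()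

  △-pair-insertAt⁺ : ∀ (X : Subset (k + n)) b u v →
    insertAt⁺ k X e b △ (⁅ punchIn⁺ k e u ⁆ ∪ ⁅ punchIn⁺ k e v ⁆) ≡ insertAt⁺ k (X △ (⁅ u ⁆ ∪ ⁅ v ⁆)) e b
  △-pair-insertAt⁺ X b u v = begin
    insertAt⁺ k X e b △ (⁅ punchIn⁺ k e u ⁆ ∪ ⁅ punchIn⁺ k e v ⁆)
      ≡⟨ cong₂ (λ p q → insertAt⁺ k X e b △ (p ∪ q)) (⁅punchIn⁺⁆ k e u) (⁅punchIn⁺⁆ k e v) ⟩
    insertAt⁺ k X e b △ (insertAt⁺ k ⁅ u ⁆ e false ∪ insertAt⁺ k ⁅ v ⁆ e false)
      ≡⟨ cong (insertAt⁺ k X e b △_) (insertAt⁺-zipWith _∨_ k ⁅ u ⁆ ⁅ v ⁆ e false false) ⟩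
    insertAt⁺ k X e b △ insertAt⁺ k (⁅ u ⁆ ∪ ⁅ v ⁆) e false
      ≡⟨ insertAt⁺-△ X (⁅ u ⁆ ∪ ⁅ v ⁆) b false ⟩
    insertAt⁺ k (X △ (⁅ u ⁆ ∪ ⁅ v ⁆)) e (b xor false)
      ≡⟨ cong (insertAt⁺ k (X △ (⁅ u ⁆ ∪ ⁅ v ⁆)) e) (xor-identityʳ b) ⟩
    insertAt⁺ k (X △ (⁅ u ⁆ ∪ ⁅ v ⁆)) e b ∎
    where open ≡-Reasoning

  module _ (b : Bool) where

    matroid-minorAt : {M : SetSystem (k + suc n)} → IsMatroid M → Proper (minorAt k e b M) → IsMatroid (minorAt k e b M)
    matroid-minorAt {M} (_ , exchangeOut) proper = proper , exchangeOut′
      where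
      exchangeOut′ : BasisExchange (minorAt k e b M)
      exchangeOut′ B₁ B₂ f₁ f₂ x x∈B₁ x∉B₂
        with exchangeOut _ _ f₁ f₂ (punchIn⁺ k e x) (∈-insertAt⁺ x∈B₁) (x∉B₂ ∘ ∈-insertAt⁺⁻)
      ... | y′ , y′∈ , y′∉ , f with punchIn⁺-surjective k e y′ (λ { refl → y′∉ (↑ʳ∈-insertAt⁺ y′∈) })
      ... | y , refl = y , ∈-insertAt⁺⁻ y′∈ , y′∉ ∘ ∈-insertAt⁺ , subst (Feasible M) (exchange-insertAt⁺ B₁ b x y) f

    deltaMatroid-minorAt : {S : SetSystem (k + suc n)} → IsDeltaMatroid S → Proper (minorAt k e b S) →
                           IsDeltaMatroid (minorAt k e b S)
    deltaMatroid-minorAt {S} (_ , exchange) proper = proper , exchange′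
      where
      exchange′ : DeltaExchange (minorAt k e b S)
      exchange′ X Y fX fY u u∈
        with exchange _ _ fX fY (punchIn⁺ k e u) (∈-△-insertAt⁺ u∈)
      ... | v′ , v′∈ , f with punchIn⁺-surjective k e v′ (λ { refl → ↑ʳ∉-△-insertAt⁺ v′∈ })
      ... | v , refl = v , ∈-△-insertAt⁺⁻ v′∈ , subst (Feasible S) (△-pair-insertAt⁺ X b u v) f

-- Basis exchange and duality

dual-proper : ∀ {S : SetSystem n} → Proper S → Proper (dual S)
dual-proper {S = S} (X , f) = ∁ X , trans (cong S (∁-involutive X)) f

dual-proper⁻ : ∀ {S : SetSystem n} → Proper (dual S) → Proper S
dual-proper⁻ (X , f) = ∁ X , f

module _ {M : SetSystem n} (isMatroid : IsMatroid M) where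

  private
    exchangeOut : BasisExchange M
    exchangeOut = proj₂ isMatroid

  basis-containing-avoiding : ∀ {a c B₁ B₂} → a ≢ c → Feasible M B₁ → a ∈ B₁ → Feasible M B₂ → c ∉ B₂ →
                              ∃[ B ] (Feasible M B × a ∈ B × c ∉ B)
  basis-containing-avoiding {a} {c} {B₁} {B₂} a≢c f₁ a∈B₁ f₂ c∉B₂ with c ∈? B₁
  ... | no  c∉B₁ = B₁ , f₁ , a∈B₁ , c∉B₁
  ... | yes c∈B₁ with exchangeOut B₁ B₂ f₁ f₂ c c∈B₁ c∉B₂
  ...   | y , y∈B₂ , _ , f = exchange B₁ c y , f , ∈-exchange⁺ a∈B₁ a≢c , c∉
    where
    c∉ : c ∉ exchange B₁ c y
    c∉ c∈ with ∈-exchange⁻ B₁ c y c∈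
    ... | inj₁ (_ , c≢c) = c≢c refl
    ... | inj₂ refl      = c∉B₂ y∈B₂

  -- B moves from B₂ towards B₁ by exchanges keeping x and B₁ ∩ B₂; once x is
  -- the only element of B outside B₁, exchanging out of B₁ some y ∉ B forces x in.
  exchange-in : ∀ {B₁ B₂ x} → Feasible M B₁ → Feasible M B₂ → x ∈ B₂ → x ∉ B₁ →
                ∃[ y ] (y ∈ B₁ × y ∉ B₂ × Feasible M (exchange B₁ y x))
  exchange-in {B₁} {B₂} {x} f₁ f₂ x∈B₂ x∉B₁ = search B₂ (<-wellFounded _) f₂ x∈B₂ (λ _ i∈B₂ → i∈B₂)
    where
    search : ∀ B → Acc _<_ ∣ B ─ B₁ ∣ → Feasible M B → x ∈ B → (∀ {i} → i ∈ B₁ → i ∈ B₂ → i ∈ B) →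
             ∃[ y ] (y ∈ B₁ × y ∉ B₂ × Feasible M (exchange B₁ y x))
    search B (acc smaller) fB x∈B common⊆B
      with any? (λ z → (z ∈? B) ×-dec ¬? (z ∈? B₁) ×-dec ¬? (z ≟ x))
    ... | yes (z , z∈B , z∉B₁ , z≢x) =
      let w , w∈B₁ , w∉B , f = exchangeOut B B₁ fB f₁ z z∈B z∉B₁
      in  search (exchange B z w) (smaller (exchange-closer z∈B z∉B₁ w∈B₁ w∉B)) f (∈-exchange⁺ x∈B (z≢x ∘ sym))
                 (λ i∈B₁ i∈B₂ → ∈-exchange⁺ (common⊆B i∈B₁ i∈B₂) λ { refl → z∉B₁ i∈B₁ })
    ... | no onlyX with exchangeOut B B₁ fB f₁ x x∈B x∉B₁
    ...   | y , y∈B₁ , y∉B , _ with exchangeOut B₁ B f₁ fB y y∈B₁ y∉B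
    ...     | w , w∈B , w∉B₁ , f with w ≟ x
    ...       | yes refl = y , y∈B₁ , (λ y∈B₂ → y∉B (common⊆B y∈B₁ y∈B₂)) , f
    ...       | no  w≢x  = contradiction (w , w∈B , w∉B₁ , w≢x) onlyX

  matroid-dual : IsMatroid (dual M)
  matroid-dual = dual-proper (proj₁ isMatroid) , exchangeOut′
    where
    exchangeOut′ : BasisExchange (dual M)
    exchangeOut′ C₁ C₂ f₁ f₂ x x∈C₁ x∉C₂ =
      let y , y∈∁C₁ , y∉∁C₂ , f = exchange-in f₁ f₂ (x∉p⇒x∈∁p x∉C₂) (x∈p⇒x∉∁p x∈C₁)
          y∉C₁ = x∈∁p⇒x∉p y∈∁C₁
      in  y , x∉∁p⇒x∈p y∉∁C₂ , y∉C₁ , subst (Feasible M) (sym (∁-exchange x∈C₁ y∉C₁)) f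

module _ {S : SetSystem n} {e : Fin n} where

  coloop⇒dual-loop : Coloop S e → Loop (dual S) e
  coloop⇒dual-loop coloop X f = x∈∁p⇒x∉p (coloop (∁ X) f)

  loop⇒dual-coloop : Loop S e → Coloop (dual S) e
  loop⇒dual-coloop loop X f = x∉∁p⇒x∈p (loop (∁ X) f)

  dual-loop⇒coloop : Loop (dual S) e → Coloop S e
  dual-loop⇒coloop loop X f = x∉∁p⇒x∈p (loop (∁ X) (subst (Feasible S) (sym (∁-involutive X)) f))

  dual-coloop⇒loop : Coloop (dual S) e → Loop S e
  dual-coloop⇒loop coloop X f = x∈∁p⇒x∉p (coloop (∁ X) (subst (Feasible S) (sym (∁-involutive X)) f))

deleteFirst-dual : ∀ {k} {M : SetSystem (k + n)} {L} → DeleteFirst k M L → ContractFirst k (dual M) (dual L)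
deleteFirst-dual done                 = done
deleteFirst-dual (stepD ¬coloop rest) = stepC (¬coloop ∘ dual-loop⇒coloop) (deleteFirst-dual rest)
deleteFirst-dual (stepC coloop rest)  = stepD (coloop⇒dual-loop coloop) (deleteFirst-dual rest)

contractFirst-dual : ∀ {k} {M : SetSystem (k + n)} {Q} → ContractFirst k M Q → DeleteFirst k (dual M) (dual Q)
contractFirst-dual done               = done
contractFirst-dual (stepC ¬loop rest) = stepD (¬loop ∘ dual-coloop⇒loop) (contractFirst-dual rest)
contractFirst-dual (stepD loop rest)  = stepC (loop⇒dual-coloop loop) (contractFirst-dual rest)

quotient-dual : ∀ {Q L : SetSystem n} → IsQuotientOf Q L → IsQuotientOf (dual L) (dual Q)
quotient-dual (k , M , L′ , Q′ , isMatroid , deleteFirst , contractFirst , L′≐L , Q′≐Q) =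
  k , dual M , dual Q′ , dual L′ , matroid-dual isMatroid ,
  contractFirst-dual contractFirst , deleteFirst-dual deleteFirst , (Q′≐Q ∘ ∁) , (L′≐L ∘ ∁)

deltaMatroid-dual : ∀ {S : SetSystem n} → IsDeltaMatroid S → IsDeltaMatroid (dual S)
deltaMatroid-dual {S = S} (proper , exchange) = dual-proper proper , exchange′
  where
  exchange′ : DeltaExchange (dual S)
  exchange′ X Y fX fY u u∈ =
    let v , v∈ , f = exchange (∁ X) (∁ Y) fX fY u (subst (u ∈_) (sym (∁-△ X Y)) u∈)
    in  v , subst (v ∈_) (∁-△ X Y) v∈ , subst (Feasible S) (sym (∁-distribˡ-△ X _)) f

-- Contracting a quotient

¬coloop-contractAt : ∀ {k n} {e : Fin (suc n)} {M : SetSystem (suc k + suc n)} → IsMatroid M →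
                     ¬ Coloop M zero → Proper (minorAt (suc k) e true M) → ¬ Coloop (minorAt (suc k) e true M) zero
¬coloop-contractAt {k} {e = e} {M} isMatroid ¬coloop (X , f) coloop
  with ¬coloop⇒delete-proper ¬coloop
... | Y , f₂ with basis-containing-avoiding isMatroid (λ ()) f (lookup⇒∈ (insertAt⁺-lookup (suc k) X e true)) f₂ (λ ())
...   | b ∷ B , fB , ↑ʳ∈B , zero∉B with coloop (b ∷ removeAt⁺ k B e) (minorAt-feasible (suc k) e true {M} fB (∈⇒lookup ↑ʳ∈B))
...     | here = zero∉B here

deleteFirst-contractAt : ∀ {k n} {e : Fin (suc n)} {M : SetSystem (k + suc n)} {L} → IsMatroid M →
                         Proper (minorAt k e true M) → DeleteFirst k M L →
                         DeleteFirst k (minorAt k e true M) (contract e L)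
deleteFirst-contractAt isMatroid proper done = done
deleteFirst-contractAt {suc k} {e = e} {M} isMatroid proper (stepD ¬coloop rest) =
  stepD ¬coloop′ (deleteFirst-contractAt (matroid-minorAt 0 zero false isMatroid (¬coloop⇒delete-proper ¬coloop))
                                         (¬coloop⇒delete-proper ¬coloop′) rest)
  where
  ¬coloop′ : ¬ Coloop (minorAt (suc k) e true M) zero
  ¬coloop′ = ¬coloop-contractAt isMatroid ¬coloop proper
deleteFirst-contractAt {suc k} {e = e} {M} isMatroid proper (stepC coloop rest) =
  stepC coloop′ (deleteFirst-contractAt (matroid-minorAt 0 zero true isMatroid (minorAt-proper⁻ k e true proper′))
                                        proper′ rest)
  where
  coloop′ : Coloop (minorAt (suc k) e true M) zero
  coloop′ = coloop-minorAt coloop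
  proper′ : Proper (contract zero (minorAt (suc k) e true M))
  proper′ = coloop⇒contract-proper proper coloop′

contractFirst-minorAt-proper : ∀ {k n} {e : Fin (suc n)} {b} {M : SetSystem (k + suc n)} {Q} →
                               ContractFirst k M Q → Proper (minorAt 0 e b Q) → Proper (minorAt k e b M)
contractFirst-minorAt-proper done          proper = proper
contractFirst-minorAt-proper (stepC _ rest) proper =
  let X , f = contractFirst-minorAt-proper rest proper in true ∷ X , f
contractFirst-minorAt-proper (stepD _ rest) proper =
  let X , f = contractFirst-minorAt-proper rest proper in false ∷ X , f

contractFirst-contractAt : ∀ {k n} {e : Fin (suc n)} {M : SetSystem (k + suc n)} {Q} → IsMatroid M →
                           Proper (contract e Q) → ContractFirst k M Q →
                           ContractFirst k (minorAt k e true M) (contract e Q)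
contractFirst-contractAt isMatroid properQ done = done
contractFirst-contractAt {suc k} {e = e} {M} isMatroid properQ (stepC _ rest) =
  stepC (contract-proper⇒¬loop proper′)
        (contractFirst-contractAt (matroid-minorAt 0 zero true isMatroid (minorAt-proper⁻ k e true proper′)) properQ rest)
  where
  proper′ : Proper (contract zero (minorAt (suc k) e true M))
  proper′ = contractFirst-minorAt-proper rest properQ
contractFirst-contractAt isMatroid properQ (stepD loop rest) =
  stepD (loop-minorAt loop)
        (contractFirst-contractAt (matroid-minorAt 0 zero false isMatroid (loop⇒delete-proper (proj₁ isMatroid) loop))
                                  properQ rest)

contractFirst-proper⁻ : ∀ {k} {M : SetSystem (k + n)} {Q} → ContractFirst k M Q → Proper Q → Proper M
contractFirst-proper⁻ done           proper = proper
contractFirst-proper⁻ (stepC _ rest) proper = let X , f = contractFirst-proper⁻ rest proper in true ∷ X , f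
contractFirst-proper⁻ (stepD _ rest) proper = let X , f = contractFirst-proper⁻ rest proper in false ∷ X , f

deleteFirst-proper : ∀ {k} {M : SetSystem (k + n)} {L} → DeleteFirst k M L → Proper M → Proper L
deleteFirst-proper done                 proper = proper
deleteFirst-proper (stepD ¬coloop rest) _      = deleteFirst-proper rest (¬coloop⇒delete-proper ¬coloop)
deleteFirst-proper (stepC coloop rest)  proper = deleteFirst-proper rest (coloop⇒contract-proper proper coloop)

quotient-proper : ∀ {Q L : SetSystem n} → IsQuotientOf Q L → Proper Q → Proper L
quotient-proper (_ , _ , _ , _ , _ , deleteFirst , contractFirst , L′≐L , Q′≐Q) =
  proper-resp L′≐L ∘ deleteFirst-proper deleteFirst ∘ contractFirst-proper⁻ contractFirst ∘ proper-resp (≐-sym Q′≐Q)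

quotient-contract : ∀ {Q L : SetSystem (suc n)} (e : Fin (suc n)) → IsQuotientOf Q L → Proper (contract e Q) →
                    IsQuotientOf (contract e Q) (contract e L)
quotient-contract e (k , M , L′ , Q′ , isMatroid , deleteFirst , contractFirst , L′≐L , Q′≐Q) properQ =
  k , minorAt k e true M , contract e L′ , contract e Q′ , matroid-minorAt k e true isMatroid properM ,
  deleteFirst-contractAt isMatroid properM deleteFirst , contractFirst-contractAt isMatroid properQ′ contractFirst ,
  (λ X → L′≐L _) , (λ X → Q′≐Q _)
  where
  properQ′ : Proper (contract e Q′)
  properQ′ = proper-resp (λ X → sym (Q′≐Q _)) properQ
  properM : Proper (minorAt k e true M)
  properM = contractFirst-minorAt-proper contractFirst properQ′

-- Layers

≡ᵇ-cong : ∀ {a b c d} → (a ≡ b → c ≡ d) → (c ≡ d → a ≡ b) → (a ≡ᵇ b) ≡ (c ≡ᵇ d)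
≡ᵇ-cong {a} {b} {c} {d} to from = does-≡ (map′ to from (a ≟ℕ b)) (c ≟ℕ d)

∣insertAt-inside∣ : ∀ (X : Subset n) e → ∣ insertAt X e inside ∣ ≡ suc ∣ X ∣
∣insertAt-inside∣ X             zero    = refl
∣insertAt-inside∣ (inside  ∷ X) (suc e) = cong suc (∣insertAt-inside∣ X e)
∣insertAt-inside∣ (outside ∷ X) (suc e) = ∣insertAt-inside∣ X e

layer-contract : ∀ (e : Fin (suc n)) S i → layer i (contract e S) ≐ contract e (layer (suc i) S)
layer-contract e S i X rewrite ∣insertAt-inside∣ X e = refl

layer-dual : ∀ (S : SetSystem n) {i} → i ≤ n → layer i (dual S) ≐ dual (layer (n ∸ i) S)
layer-dual {n} S {i} i≤n X = cong (S (∁ X) ∧_) (≡ᵇ-cong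
  (λ ∣X∣≡i → trans (∣∁p∣≡n∸∣p∣ X) (cong (n ∸_) ∣X∣≡i))
  (λ ∣∁X∣≡n∸i → ∸-cancelˡ-≡ (∣p∣≤n X) i≤n (trans (sym (∣∁p∣≡n∸∣p∣ X)) ∣∁X∣≡n∸i)))

layer-proper⇒≤ : ∀ {S : SetSystem n} {i} → Proper (layer i S) → i ≤ n
layer-proper⇒≤ {S = S} {i} (X , f) with S X
... | true = subst (_≤ _) (≡ᵇ⇒≡ ∣ X ∣ i (subst T (sym f) _)) (∣p∣≤n X)

none-between : ∀ {p} (P : ℕ → Set p) {a b} →
               (∀ l → a < l → l < b → (∀ m → a < m → m < l → ¬ P m) → ¬ P l) →
               ∀ l → a < l → l < b → ¬ P l
none-between P {a} {b} refuteMinimal l = go l (<-wellFounded l)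
  where
  go : ∀ l → Acc _<_ l → a < l → l < b → ¬ P l
  go l (acc smaller) a<l l<b = refuteMinimal l a<l l<b λ m a<m m<l → go m (smaller m<l) a<m (<-trans m<l l<b)

-- Closure under contraction, duality and minors

ConsecutiveQuotients : SetSystem n → Set
ConsecutiveQuotients S =
  ∀ i j → i < j → Proper (layer i S) → Proper (layer j S) →
  (∀ l → i < l → l < j → ¬ Proper (layer l S)) → IsQuotientOf (layer i S) (layer j S)

contract-quotientDeltaMatroid : ∀ {S : SetSystem (suc n)} e → IsQuotientDeltaMatroid S → Proper (contract e S) →
                                IsQuotientDeltaMatroid (contract e S)
contract-quotientDeltaMatroid {S = S} e ((isStack , isQuotient) , isDeltaMatroid) proper =
  (stack , quotient) , deltaMatroid-minorAt 0 e true isDeltaMatroid proper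
  where
  toS : ∀ i → Proper (layer i (contract e S)) → Proper (contract e (layer (suc i) S))
  toS i = proper-resp (layer-contract e S i)

  fromS : ∀ i → Proper (contract e (layer (suc i) S)) → Proper (layer i (contract e S))
  fromS i = proper-resp (≐-sym (layer-contract e S i))

  lift : ∀ i → Proper (layer i (contract e S)) → Proper (layer (suc i) S)
  lift i = minorAt-proper⁻ 0 e true ∘ toS i

  stack : IsMatroidStack (contract e S)
  stack i properᵢ = matroid-resp (≐-sym (layer-contract e S i))
    (matroid-minorAt 0 e true (isStack (suc i) (lift i properᵢ)) (toS i properᵢ))

  quotient : ConsecutiveQuotients (contract e S)
  quotient i j i<j properᵢ properⱼ gap =
    quotientOf-resp (≐-sym (layer-contract e S i)) (≐-sym (layer-contract e S j))
      (quotient-contract e (isQuotient (suc i) (suc j) (s<s i<j) (lift i properᵢ) (lift j properⱼ) gapS) (toS i properᵢ))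
    where
    gapS : ∀ l → suc i < l → l < suc j → ¬ Proper (layer l S)
    gapS = none-between (λ l → Proper (layer l S)) λ where
      (suc l) i<l l<j below properₗ →
        let quotientₗ = isQuotient (suc i) (suc l) i<l (lift i properᵢ) properₗ below
        in  gap l (≤-pred i<l) (≤-pred l<j)
                (fromS l (quotient-proper (quotient-contract e quotientₗ (toS i properᵢ)) (toS i properᵢ)))

dual-quotientDeltaMatroid : ∀ {S : SetSystem n} → IsQuotientDeltaMatroid S → IsQuotientDeltaMatroid (dual S)
dual-quotientDeltaMatroid {n} {S} ((isStack , isQuotient) , isDeltaMatroid) =
  (stack , quotient) , deltaMatroid-dual isDeltaMatroid
  where
  toS : ∀ {i} → Proper (layer i (dual S)) → Proper (layer (n ∸ i) S)
  toS properᵢ = dual-proper⁻ (proper-resp (layer-dual S (layer-proper⇒≤ properᵢ)) properᵢ)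

  fromS : ∀ {l} → Proper (layer l S) → Proper (layer (n ∸ l) (dual S))
  fromS {l} properₗ = proper-resp (≐-sym (layer-dual S (m∸n≤m n l)))
    (subst (λ m → Proper (dual (layer m S))) (sym (m∸[m∸n]≡n (layer-proper⇒≤ properₗ))) (dual-proper properₗ))

  stack : IsMatroidStack (dual S)
  stack i properᵢ = matroid-resp (≐-sym (layer-dual S (layer-proper⇒≤ properᵢ))) (matroid-dual (isStack (n ∸ i) (toS properᵢ)))

  quotient : ConsecutiveQuotients (dual S)
  quotient i j i<j properᵢ properⱼ gap =
    quotientOf-resp (≐-sym (layer-dual S i≤n)) (≐-sym (layer-dual S j≤n))
      (quotient-dual (isQuotient (n ∸ j) (n ∸ i) (∸-monoʳ-< i<j j≤n) (toS properⱼ) (toS properᵢ) gapS))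
    where
    i≤n : i ≤ n
    i≤n = layer-proper⇒≤ properᵢ
    j≤n : j ≤ n
    j≤n = layer-proper⇒≤ properⱼ
    gapS : ∀ l → n ∸ j < l → l < n ∸ i → ¬ Proper (layer l S)
    gapS l n∸j<l l<n∸i properₗ = gap (n ∸ l) i<n∸l n∸l<j (fromS properₗ)
      where
      i<n∸l : i < n ∸ l
      i<n∸l = subst (_< n ∸ l) (m∸[m∸n]≡n i≤n) (∸-monoʳ-< l<n∸i (m∸n≤m n i))
      n∸l<j : n ∸ l < j
      n∸l<j = subst (n ∸ l <_) (m∸[m∸n]≡n j≤n) (∸-monoʳ-< n∸j<l (layer-proper⇒≤ properₗ))

delete≐dual-contract-dual : ∀ (e : Fin (suc n)) S → delete e S ≐ dual (contract e (dual S))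
delete≐dual-contract-dual e S X = cong S (begin
  insertAt X e false           ≡⟨ cong (λ Y → insertAt Y e false) (∁-involutive X) ⟨
  insertAt (∁ (∁ X)) e false   ≡⟨ map-insertAt not true (∁ X) e ⟨
  ∁ (insertAt (∁ X) e true)    ∎)
  where open ≡-Reasoning

delete-quotientDeltaMatroid : ∀ {S : SetSystem (suc n)} e → IsQuotientDeltaMatroid S → Proper (delete e S) →
                              IsQuotientDeltaMatroid (delete e S)
delete-quotientDeltaMatroid {S = S} e isQDM proper =
  quotientDeltaMatroid-resp (≐-sym deletion)
    (dual-quotientDeltaMatroid
      (contract-quotientDeltaMatroid e (dual-quotientDeltaMatroid isQDM) (dual-proper⁻ (proper-resp deletion proper))))
  where
  deletion : delete e S ≐ dual (contract e (dual S))
  deletion = delete≐dual-contract-dual e S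

step-quotientDeltaMatroid : ∀ {S : SetSystem (suc n)} {T} → Step S T →
                            IsQuotientDeltaMatroid S → IsQuotientDeltaMatroid T
step-quotientDeltaMatroid (con _ e ¬loop)            isQDM = contract-quotientDeltaMatroid e isQDM (¬loop⇒contract-proper ¬loop)
step-quotientDeltaMatroid (conLoop proper e loop)     isQDM = delete-quotientDeltaMatroid e isQDM (loop⇒delete-proper proper loop)
step-quotientDeltaMatroid (del _ e ¬coloop)          isQDM = delete-quotientDeltaMatroid e isQDM (¬coloop⇒delete-proper ¬coloop)
step-quotientDeltaMatroid (delColoop proper e coloop) isQDM = contract-quotientDeltaMatroid e isQDM (coloop⇒contract-proper proper coloop)

minor-quotientDeltaMatroid : ∀ {m} {S : SetSystem n} {T : SetSystem m} → Minor S T →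
                             IsQuotientDeltaMatroid S → IsQuotientDeltaMatroid T
minor-quotientDeltaMatroid here              isQDM = isQDM
minor-quotientDeltaMatroid (there step rest) isQDM = minor-quotientDeltaMatroid rest (step-quotientDeltaMatroid step isQDM)

lemma6p11 : ∀ {n} (S : SetSystem n) → IsQuotientDeltaMatroid S →
              ((∀ {m} (T : SetSystem m) → Minor S T → IsQuotientDeltaMatroid T) ×
               IsQuotientDeltaMatroid (dual S))
lemma6p11 S isQDM = (λ T minor → minor-quotientDeltaMatroid minor isQDM) , dual-quotientDeltaMatroid isQDM
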